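{- Let $k\ge 2$ and $a$ be positive integers, let $M$ be a strongly $k$-chromatic-choosable graph with $V(M)=\{v_1,\dots,v_n\}$, and let $H = M\square K_{a,1}$, where $K_{a,1}$ has partite sets $X=\{x_1,\dots,x_a\}$ and $\{y_1\}$. Let $L$ be a $(k+a-1)$-assignment for $H$ such that, for each $i\in[n]$, the lists $L(v_i,x_1),\dots,L(v_i,x_a)$ are pairwise disjoint. Let $\mathcal{B}$ be the set of proper $L_X$-colorings of $H_X$ that are bad for $H_{y_1}$, and let $\mathcal{B}_I$ be the set of elements of $\mathcal{B}$ that are $(n-1)$-to-1. If $\mathcal{B}_I\neq\emptyset$, then $|\mathcal{B}_I| = 1$ and $\mathcal{B}=\mathcal{B}_I$.
   Context: The Cartesian product $G \square H$ has vertex set $V(G)\times V(H)$, with $(u,v)$ adjacent to $(u',v')$ iff either $u=u'$ and $vv'\in E(H)$, or $v=v'$ and $uu'\in E(G)$. A $k$-assignment assigns each vertex a list of $k$ colors; a proper $L$-coloring is a proper coloring choosing each vertex's color from its list. A graph is $k$-vertex critical if its chromatic number is $k$ and deleting any vertex decreases the chromatic number; $G$ is strongly $k$-chromatic-choosable if it is $k$-vertex critical and every $(k-1)$-assignment $L$ for which $G$ has no proper $L$-coloring assigns the same list to all vertices. $H_X$ is the subgraph of $H$ induced by $\{(v_i,x_j): i\in[n], j\in[a]\}$ and $L_X$ is the restriction of $L$ to it; $H_{y_1}$ is the subgraph induced by $\{(v_i,y_1): i\in[n]\}$ (a copy of $M$). A proper $L_X$-coloring $f$ of $H_X$ is bad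 for $H_{y_1}$ if $H_{y_1}$ has no proper $L'$-coloring, where $L'(v_j,y_1) = L(v_j,y_1)\setminus\{f(v_j,x_l): l\in[a]\}$ for each $j\in[n]$. A coloring $f$ is $(n-1)$-to-1 if every color $q$ in its range satisfies $|f^{ -1}(q)|\le n-1$. -}

module Defs where

open import Level using (0ℓ)
open import Data.Nat using (ℕ; _≤_; _<_; _∸_; _+_; _≟_)
open import Data.Fin using (Fin)
open import Data.Fin.Properties using () renaming (_≟_ to _≟ᶠ_)
open import Data.Unit using (⊤; tt)
open import Data.Empty using (⊥)
open import Data.Sum using (_⊎_; inj₁; inj₂)
open import Data.Product using (Σ; ∃; _×_; _,_; proj₁; proj₂)
open import Data.List using (List; length; filter; map; cartesianProduct; allFin)
open import Data.List.Membership.Propositional using (_∈_)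
open import Data.List.Membership.DecPropositional _≟_ using (_∈?_)
open import Data.List.Relation.Unary.Unique.Propositional using (Unique)
open import Relation.Nullary using (¬_; ¬?)
open import Relation.Binary.PropositionalEquality using (_≡_; _≢_; refl)
open import Function.Bundles using (_⇔_)

record Graph (V : Set) : Set₁ where
  field
    Adj    : V → V → Set
    sym    : ∀ {u v} → Adj u v → Adj v u
    irrefl : ∀ {v} → ¬ Adj v v
open Graph public using (Adj)

-- Subgraph induced by the image of a map ι : W → V (ι injective in all uses)
induced : {V W : Set} → Graph V → (W → V) → Graph W
induced G ι = record
  { Adj = λ u v → Adj G (ι u) (ι v)
  ; sym = Graph.sym G
  ; irrefl = Graph.irrefl G }

deleteVertex : {V : Set} → Graph V → (v : V) → Graph (Σ V (λ u → u ≢ v))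
deleteVertex G v = induced G proj₁

_□_ : {V W : Set} → Graph V → Graph W → Graph (V × W)
_□_ {V} {W} G H = record { Adj = A ; sym = s ; irrefl = i }
  where
  A : V × W → V × W → Set
  A (u , v) (u' , v') = (u ≡ u' × Adj H v v') ⊎ (v ≡ v' × Adj G u u')
  s : ∀ {p q} → A p q → A q p
  s (inj₁ (refl , h)) = inj₁ (refl , Graph.sym H h)
  s (inj₂ (refl , g)) = inj₂ (refl , Graph.sym G g)
  i : ∀ {p} → ¬ A p p
  i (inj₁ (_ , h)) = Graph.irrefl H h
  i (inj₂ (_ , g)) = Graph.irrefl G g

-- Complete bipartite graph K_{a,1}: partite sets X = Fin a and {y₁} = ⊤
K : (a : ℕ) → Graph (Fin a ⊎ ⊤)
K a = record { Adj = A ; sym = s ; irrefl = i }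
  where
  A : Fin a ⊎ ⊤ → Fin a ⊎ ⊤ → Set
  A (inj₁ _) (inj₂ _) = ⊤
  A (inj₂ _) (inj₁ _) = ⊤
  A _ _ = ⊥
  s : ∀ {p q} → A p q → A q p
  s {inj₁ _} {inj₂ _} _ = tt
  s {inj₂ _} {inj₁ _} _ = tt
  i : ∀ {p} → ¬ A p p
  i {inj₁ _} ()
  i {inj₂ _} ()

Colorable : {V : Set} → Graph V → ℕ → Set
Colorable {V} G m = Σ (V → Fin m) λ c → ∀ u v → Adj G u v → c u ≢ c v

ChromaticNumber : {V : Set} → Graph V → ℕ → Set
ChromaticNumber G k = Colorable G k × (∀ m → m < k → ¬ Colorable G m)

VertexCritical : {V : Set} → Graph V → ℕ → Set
VertexCritical {V} G k =
  ChromaticNumber G k × (∀ v → ∃ λ m → m < k × Colorable (deleteVertex G v) m)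

Assignment : Set → Set
Assignment V = V → List ℕ

IsKAssignment : {V : Set} → ℕ → Assignment V → Set
IsKAssignment {V} k L = ∀ v → Unique (L v) × length (L v) ≡ k

ProperLColoring : {V : Set} → Graph V → Assignment V → (V → ℕ) → Set
ProperLColoring {V} G L f = (∀ v → f v ∈ L v) × (∀ u v → Adj G u v → f u ≢ f v)

LColorable : {V : Set} → Graph V → Assignment V → Set
LColorable {V} G L = Σ (V → ℕ) (ProperLColoring G L)

SameLists : {V : Set} → Assignment V → Set
SameLists {V} L = ∀ u v c → (c ∈ L u) ⇔ (c ∈ L v)

StronglyChromaticChoosable : {V : Set} → Graph V → ℕ → Set
StronglyChromaticChoosable {V} G k =
  VertexCritical G k ×
  (∀ (L : Assignment V) → IsKAssignment (k ∸ 1) L → ¬ LColorable G L → SameLists L)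

module Setting {n : ℕ} (M : Graph (Fin n)) (a : ℕ) where

  VH : Set
  VH = Fin n × (Fin a ⊎ ⊤)

  H : Graph VH
  H = M □ K a

  ιX : Fin n × Fin a → VH
  ιX (i , j) = (i , inj₁ j)

  ιY : Fin n → VH
  ιY i = (i , inj₂ tt)

  HX : Graph (Fin n × Fin a)
  HX = induced H ιX

  Hy : Graph (Fin n)
  Hy = induced H ιY

  module _ (L : Assignment VH) where

    LX : Assignment (Fin n × Fin a)
    LX p = L (ιX p)

    L' : (Fin n × Fin a → ℕ) → Assignment (Fin n)
    L' f i = filter (λ c → ¬? (c ∈? map (λ l → f (i , l)) (allFin a))) (L (ιY i))

    InB : (Fin n × Fin a → ℕ) → Set
    InB f = ProperLColoring HX LX f × ¬ LColorable Hy (L' f)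

    preimageSize : (Fin n × Fin a → ℕ) → ℕ → ℕ
    preimageSize f q =
      length (filter (λ p → f p ≟ q) (cartesianProduct (allFin n) (allFin a)))

    NToOne : (Fin n × Fin a → ℕ) → Set
    NToOne f = ∀ p → preimageSize f (f p) ≤ n ∸ 1

    InBI : (Fin n × Fin a → ℕ) → Set
    InBI f = InB f × NToOne f

{-# OPTIONS --safe #-}
-- For a bad coloring g, the lists L' of H_{y_1} ≅ M keep at least k − 1 colors, and an
-- uncolorable assignment of a strongly k-chromatic-choosable graph with lists of at least
-- k − 1 colors has lists of exactly k − 1 colors. So L'_g is a constant (k − 1)-assignment
-- and every color g(v_i, x_l) lies in L(v_i, y_1). If f is moreover (n − 1)-to-1, no color
-- of L'_g is missing from L'_f (f would use it in all n rows), so L'_g = L'_f; then every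
-- g(v_i, x_l) equals some f(v_i, x_l'), and the disjointness of the lists L(v_i, x_·)
-- forces l = l', i.e. g = f.
module Submission where

open import Defs
open import Data.Nat using (ℕ; zero; suc; _≤_; _<_; _+_; _∸_; s≤s; z≤n)
open import Data.Nat.Properties
  using ( ≤-reflexive; ≤-trans; ≤-antisym; <-irrefl; ≮⇒≥; <⇒≱; m≤pred[n]⇒suc[m]≤n
        ; +-suc; +-comm; +-monoˡ-≤; +-monoˡ-<; +-cancelʳ-≤; m≤n⇒m⊓n≡m; module ≤-Reasoning)
import Data.Nat as ℕ
open import Data.Fin using (Fin)
import Data.Fin as Fin
open import Data.Fin.Properties using (nonZeroIndex) renaming (_≟_ to _≟ᶠ_)
open import Data.Vec.Functional using (updateAt)
open import Data.Vec.Functional.Properties using (updateAt-updates; updateAt-minimal)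
open import Data.Sum using (inj₁; inj₂)
open import Data.Product using (∃; _×_; _,_; proj₁; proj₂)
open import Data.List using (List; []; _∷_; _++_; length; filter; map; take; allFin; cartesianProduct)
open import Data.List.Properties using (length-++; length-map; length-tabulate; length-take; filter-≐)
open import Data.List.Membership.Propositional using (_∈_; _∉_)
open import Data.List.Membership.Propositional.Properties
  using ( ∈-filter⁺; ∈-filter⁻; ∈-map⁺; ∈-map⁻; ∈-allFin; ∈-cartesianProduct⁺
        ; ∈-∃++; ∈-++⁻; ∈-++⁺ˡ; ∈-++⁺ʳ)
open import Data.List.Membership.DecPropositional ℕ._≟_ using (_∈?_)
open import Data.List.Relation.Binary.Subset.Propositional using (_⊆_)
open import Data.List.Relation.Binary.Subset.Propositional.Properties using (∈-∷⁺ʳ)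
open import Data.List.Relation.Binary.Sublist.Propositional using (⊆-refl; lookup)
open import Data.List.Relation.Binary.Sublist.Heterogeneous.Properties using (take-Sublist)
open import Data.List.Relation.Unary.Any using (here; there)
import Data.List.Relation.Unary.All as All
open import Data.List.Relation.Unary.All.Properties using (¬Any⇒All¬)
open import Data.List.Relation.Unary.AllPairs using (_∷_)
open import Data.List.Relation.Unary.Unique.Propositional using (Unique)
import Data.List.Relation.Unary.Unique.Propositional.Properties as Unique
open import Relation.Nullary using (¬_; Dec; yes; no; ¬?; contradiction)
open import Relation.Binary.PropositionalEquality
  using (_≡_; _≢_; refl; sym; trans; cong; cong₂; subst; module ≡-Reasoning)
open import Function.Base using (_∘_)
open import Function.Bundles using (Equivalence)

Unique-⊆⇒length≤ : {A : Set} {xs ys : List A} → Unique xs → xs ⊆ ys → length xs ≤ length ys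
Unique-⊆⇒length≤ {xs = []} _ _ = z≤n
Unique-⊆⇒length≤ {xs = x ∷ xs} (x∉xs ∷ !xs) x∷xs⊆ys
  with us , vs , refl ← ∈-∃++ (x∷xs⊆ys (here refl)) = begin
    suc (length xs)              ≤⟨ s≤s (Unique-⊆⇒length≤ !xs xs⊆us++vs) ⟩
    suc (length (us ++ vs))      ≡⟨ cong suc (length-++ us) ⟩
    suc (length us + length vs)  ≡⟨ +-suc (length us) (length vs) ⟨
    length us + length (x ∷ vs)  ≡⟨ length-++ us ⟨
    length (us ++ x ∷ vs)        ∎
  where
  open ≤-Reasoning
  xs⊆us++vs : xs ⊆ us ++ vs
  xs⊆us++vs y∈xs with ∈-++⁻ us (x∷xs⊆ys (there y∈xs))
  ... | inj₁ y∈us         = ∈-++⁺ˡ y∈us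
  ... | inj₂ (here y≡x)   = contradiction (sym y≡x) (All.lookup x∉xs y∈xs)
  ... | inj₂ (there y∈vs) = ∈-++⁺ʳ us y∈vs

length-filter+length-filter∁ : {A : Set} {P : A → Set} (P? : ∀ x → Dec (P x)) (xs : List A) →
  length (filter P? xs) + length (filter (λ x → ¬? (P? x)) xs) ≡ length xs
length-filter+length-filter∁ P? [] = refl
length-filter+length-filter∁ P? (x ∷ xs) with P? x
... | yes _ = cong suc (length-filter+length-filter∁ P? xs)
... | no _  = trans (+-suc _ _) (cong suc (length-filter+length-filter∁ P? xs))

∈-take⁻ : {A : Set} (m : ℕ) {x : A} {xs : List A} → x ∈ take m xs → x ∈ xs
∈-take⁻ m = lookup (take-Sublist m ⊆-refl)

take-Unique-length : {A : Set} (m : ℕ) {xs : List A} → Unique xs → m ≤ length xs →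
  Unique (take m xs) × length (take m xs) ≡ m
take-Unique-length m {xs} !xs m≤|xs| =
  Unique.take⁺ m !xs , trans (length-take m xs) (m≤n⇒m⊓n≡m m≤|xs|)

⊆-length≤⇒⊇ : {xs ys : List ℕ} → Unique xs → xs ⊆ ys → length ys ≤ length xs → ys ⊆ xs
⊆-length≤⇒⊇ {xs} !xs xs⊆ys |ys|≤|xs| {y} y∈ys with y ∈? xs
... | yes y∈xs = y∈xs
... | no y∉xs  = contradiction |ys|≤|xs|
  (<⇒≱ (Unique-⊆⇒length≤ (¬Any⇒All¬ xs y∉xs ∷ !xs) (∈-∷⁺ʳ y∈ys xs⊆ys)))

_∩_ : List ℕ → List ℕ → List ℕ
ys ∩ xs = filter (_∈? xs) ys

_∖_ : List ℕ → List ℕ → List ℕ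
ys ∖ xs = filter (λ c → ¬? (c ∈? xs)) ys

module _ (ys xs : List ℕ) where

  ∖-⊆ : ys ∖ xs ⊆ ys
  ∖-⊆ c∈ = proj₁ (∈-filter⁻ (λ c → ¬? (c ∈? xs)) {xs = ys} c∈)

  ∖-Unique : Unique ys → Unique (ys ∖ xs)
  ∖-Unique = Unique.filter⁺ (λ c → ¬? (c ∈? xs))

  ∉-∖⇒∈ : ∀ {c} → c ∈ ys → c ∉ ys ∖ xs → c ∈ xs
  ∉-∖⇒∈ {c} c∈ys c∉ys∖xs with c ∈? xs
  ... | yes c∈xs = c∈xs
  ... | no c∉xs  = contradiction (∈-filter⁺ (λ c → ¬? (c ∈? xs)) c∈ys c∉xs) c∉ys∖xs

  ∈⇒∉-∖ : ∀ {c} → c ∈ xs → c ∉ ys ∖ xs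
  ∈⇒∉-∖ c∈xs c∈ys∖xs = proj₂ (∈-filter⁻ (λ c → ¬? (c ∈? xs)) {xs = ys} c∈ys∖xs) c∈xs

module _ {xs ys : List ℕ} (!ys : Unique ys) where

  private
    !ys∩xs : Unique (ys ∩ xs)
    !ys∩xs = Unique.filter⁺ (_∈? xs) !ys

    ys∩xs⊆xs : ys ∩ xs ⊆ xs
    ys∩xs⊆xs c∈ = proj₂ (∈-filter⁻ (_∈? xs) {xs = ys} c∈)

    open ≤-Reasoning

  length-∖-lower : length ys ≤ length (ys ∖ xs) + length xs
  length-∖-lower = begin
    length ys                                ≡⟨ length-filter+length-filter∁ (_∈? xs) ys ⟨
    length (ys ∩ xs) + length (ys ∖ xs)      ≤⟨ +-monoˡ-≤ _ (Unique-⊆⇒length≤ !ys∩xs ys∩xs⊆xs) ⟩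
    length xs + length (ys ∖ xs)             ≡⟨ +-comm (length xs) _ ⟩
    length (ys ∖ xs) + length xs             ∎

  length-∖-tight⇒⊆ : length (ys ∖ xs) + length xs ≤ length ys → xs ⊆ ys
  length-∖-tight⇒⊆ tight {c} c∈xs with c ∈? ys
  ... | yes c∈ys = c∈ys
  ... | no c∉ys  = contradiction tight (<⇒≱ (begin-strict
    length ys                                ≡⟨ length-filter+length-filter∁ (_∈? xs) ys ⟨
    length (ys ∩ xs) + length (ys ∖ xs)      <⟨ +-monoˡ-< _ |ys∩xs|<|xs| ⟩
    length xs + length (ys ∖ xs)             ≡⟨ +-comm (length xs) _ ⟩
    length (ys ∖ xs) + length xs             ∎))
    where
    |ys∩xs|<|xs| : length (ys ∩ xs) < length xs
    |ys∩xs|<|xs| = Unique-⊆⇒length≤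
      (¬Any⇒All¬ _ (λ c∈ys∩xs → c∉ys (proj₁ (∈-filter⁻ (_∈? xs) c∈ys∩xs))) ∷ !ys∩xs)
      (∈-∷⁺ʳ c∈xs ys∩xs⊆xs)

LColorable-mono : {V : Set} (G : Graph V) {Λ Λ′ : Assignment V} →
  (∀ v → Λ v ⊆ Λ′ v) → LColorable G Λ → LColorable G Λ′
LColorable-mono _ Λ⊆Λ′ (c , c∈Λ , proper) = c , (λ v → Λ⊆Λ′ v (c∈Λ v)) , proper

another-vertex : {n : ℕ} (G : Graph (Fin n)) → ¬ Colorable G 1 → (v : Fin n) → ∃ λ u → u ≢ v
another-vertex {suc zero} G ¬1-col Fin.zero = contradiction ((λ _ → Fin.zero) , proper) ¬1-col
  where
  proper : ∀ u v → Adj G u v → Fin.zero ≢ Fin.zero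
  proper Fin.zero Fin.zero uv _ = Graph.irrefl G uv
another-vertex {suc (suc _)} _ _ Fin.zero    = Fin.suc Fin.zero , λ ()
another-vertex {suc (suc _)} _ _ (Fin.suc _) = Fin.zero , λ ()

BadAssignmentsConstant : {V : Set} → Graph V → ℕ → Set
BadAssignmentsConstant {V} G m =
  ∀ (Λ : Assignment V) → IsKAssignment m Λ → ¬ LColorable G Λ → SameLists Λ

module _ {n m : ℕ} {G : Graph (Fin n)}
         (constant : BadAssignmentsConstant G (suc m)) (¬1-col : ¬ Colorable G 1) where

  private
    truncate : Assignment (Fin n) → Assignment (Fin n)
    truncate Λ v = take (suc m) (Λ v)

    truncate-constant : (Λ : Assignment (Fin n)) → (∀ v → Unique (Λ v)) →
      (∀ v → suc m ≤ length (Λ v)) → ¬ LColorable G Λ → SameLists (truncate Λ)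
    truncate-constant Λ !Λ long ¬col = constant (truncate Λ)
      (λ v → take-Unique-length (suc m) (!Λ v) (long v))
      (¬col ∘ LColorable-mono G (λ v → ∈-take⁻ (suc m)))

  -- If Λ v = x ∷ xs were longer than m + 1, removing x at v would keep Λ uncolorable,
  -- and comparing the two truncations through another vertex would put x back into xs.
  bad-assignment-not-long : (Λ : Assignment (Fin n)) → (∀ v → Unique (Λ v)) →
    (∀ v → suc m ≤ length (Λ v)) → ¬ LColorable G Λ →
    ∀ v {x xs} → Λ v ≡ x ∷ xs → ¬ (suc m ≤ length xs)
  bad-assignment-not-long Λ !Λ long ¬col v {x} {xs} Λv≡x∷xs |xs|≥ = x∉xs (∈-take⁻ (suc m) x∈T′v)
    where
    !x∷xs : Unique (x ∷ xs)
    !x∷xs = subst Unique Λv≡x∷xs (!Λ v)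

    x∉xs : x ∉ xs
    x∉xs = Unique.Unique[x∷xs]⇒x∉xs !x∷xs

    Λ′ : Assignment (Fin n)
    Λ′ = updateAt Λ v (λ _ → xs)

    Λ′-shrinks : ∀ w → Unique (Λ′ w) × suc m ≤ length (Λ′ w) × Λ′ w ⊆ Λ w
    Λ′-shrinks w with w ≟ᶠ v
    ... | yes refl rewrite updateAt-updates v {λ _ → xs} Λ | Λv≡x∷xs =
      Unique.drop⁺ 1 !x∷xs , |xs|≥ , there
    ... | no w≢v rewrite updateAt-minimal w v {λ _ → xs} Λ w≢v = !Λ w , long w , λ p → p

    u : Fin n
    u = proj₁ (another-vertex G ¬1-col v)

    T′-constant : SameLists (truncate Λ′)
    T′-constant = truncate-constant Λ′ (proj₁ ∘ Λ′-shrinks) (proj₁ ∘ proj₂ ∘ Λ′-shrinks)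
      (¬col ∘ LColorable-mono G (proj₂ ∘ proj₂ ∘ Λ′-shrinks))

    x∈Tv : x ∈ truncate Λ v
    x∈Tv rewrite Λv≡x∷xs = here refl

    x∈T′u : x ∈ truncate Λ′ u
    x∈T′u rewrite updateAt-minimal u v {λ _ → xs} Λ (proj₂ (another-vertex G ¬1-col v)) =
      Equivalence.to (truncate-constant Λ !Λ long ¬col v u x) x∈Tv

    x∈T′v : x ∈ take (suc m) xs
    x∈T′v = subst (λ ys → x ∈ take (suc m) ys) (updateAt-updates v {λ _ → xs} Λ)
      (Equivalence.to (T′-constant u v x) x∈T′u)

  uncolorable⇒IsKAssignment : (Λ : Assignment (Fin n)) → (∀ v → Unique (Λ v)) →
    (∀ v → suc m ≤ length (Λ v)) → ¬ LColorable G Λ → IsKAssignment (suc m) Λ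
  uncolorable⇒IsKAssignment Λ !Λ long ¬col v = !Λ v , ≤-antisym (short (Λ v) refl) (long v)
    where
    short : ∀ ys → Λ v ≡ ys → length ys ≤ suc m
    short []       _        = z≤n
    short (x ∷ xs) Λv≡x∷xs = s≤s (≮⇒≥ (bad-assignment-not-long Λ !Λ long ¬col v Λv≡x∷xs))

module _ {n : ℕ} (M : Graph (Fin n)) (a : ℕ) where
  open Setting M a

  colorsAt : (Fin n × Fin a → ℕ) → Fin n → List ℕ
  colorsAt f i = map (λ l → f (i , l)) (allFin a)

  length-colorsAt : ∀ f i → length (colorsAt f i) ≡ a
  length-colorsAt f i = trans (length-map _ (allFin a)) (length-tabulate _)

  ∈-colorsAt⁺ : ∀ f i l → f (i , l) ∈ colorsAt f i
  ∈-colorsAt⁺ f i l = ∈-map⁺ (λ l → f (i , l)) (∈-allFin l)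

  ∈-colorsAt⁻ : ∀ f i {c} → c ∈ colorsAt f i → ∃ λ l → f (i , l) ≡ c
  ∈-colorsAt⁻ f i c∈ with l , _ , c≡ ← ∈-map⁻ _ c∈ = l , sym c≡

  LColorable-M⇒Hy : ∀ {Λ} → LColorable M Λ → LColorable Hy Λ
  LColorable-M⇒Hy (c , c∈Λ , proper) = c , c∈Λ , λ where
    u v (inj₂ (_ , uv)) → proper u v uv

  module _ (L : Assignment VH) where

    n≤preimageSize : ∀ f c → (∀ i → c ∈ colorsAt f i) → n ≤ preimageSize L f c
    n≤preimageSize f c c∈rows = begin
      n                          ≡⟨ trans (length-map pick (allFin n)) (length-tabulate _) ⟨
      length (map pick (allFin n)) ≤⟨ Unique-⊆⇒length≤ !picks picks⊆f⁻¹c ⟩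
      preimageSize L f c         ∎
      where
      open ≤-Reasoning
      pick : Fin n → Fin n × Fin a
      pick i = i , proj₁ (∈-colorsAt⁻ f i (c∈rows i))

      !picks : Unique (map pick (allFin n))
      !picks = Unique.map⁺ (cong proj₁) (Unique.allFin⁺ n)

      picks⊆f⁻¹c : map pick (allFin n) ⊆
                   filter (λ p → f p ℕ.≟ c) (cartesianProduct (allFin n) (allFin a))
      picks⊆f⁻¹c p∈ with i , _ , refl ← ∈-map⁻ pick p∈ =
        ∈-filter⁺ (λ p → f p ℕ.≟ c) (∈-cartesianProduct⁺ (∈-allFin i) (∈-allFin _))
          (proj₂ (∈-colorsAt⁻ f i (c∈rows i)))

    NToOne⇒¬∈-every-colorsAt : ∀ {f} → NToOne L f → Fin n → ∀ c → ¬ (∀ i → c ∈ colorsAt f i)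
    NToOne⇒¬∈-every-colorsAt {f} n-1-to-1 v c c∈rows with l , refl ← ∈-colorsAt⁻ f v (c∈rows v) =
      <-irrefl refl (m≤pred[n]⇒suc[m]≤n {{nonZeroIndex v}}
        (≤-trans (n≤preimageSize f c c∈rows) (n-1-to-1 (v , l))))

    preimageSize-resp-≗ : ∀ {f g} → (∀ p → g p ≡ f p) →
                          ∀ c → preimageSize L g c ≡ preimageSize L f c
    preimageSize-resp-≗ {f} {g} g≗f c = cong length
      (filter-≐ (λ p → g p ℕ.≟ c) (λ p → f p ℕ.≟ c)
        ((λ {p} → trans (sym (g≗f p))) , (λ {p} → trans (g≗f p)))
        (cartesianProduct (allFin n) (allFin a)))

    NToOne-resp-≗ : ∀ {f g} → (∀ p → g p ≡ f p) → NToOne L f → NToOne L g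
    NToOne-resp-≗ {f} {g} g≗f n-1-to-1 p = subst (_≤ n ∸ 1) (sym (begin
      preimageSize L g (g p) ≡⟨ preimageSize-resp-≗ g≗f (g p) ⟩
      preimageSize L f (g p) ≡⟨ cong (preimageSize L f) (g≗f p) ⟩
      preimageSize L f (f p) ∎)) (n-1-to-1 p)
      where open ≡-Reasoning

    module _ {m : ℕ} (constant : BadAssignmentsConstant M (suc m)) (¬1-col : ¬ Colorable M 1)
             (isK : IsKAssignment (suc m + a) L) where

      private
        !Y : ∀ i → Unique (L (ιY i))
        !Y i = proj₁ (isK (ιY i))

        |Y| : ∀ i → length (L (ιY i)) ≡ suc m + a
        |Y| i = proj₂ (isK (ιY i))

      -- L' removes at most a of the m + 1 + a colors of each list.
      bad⇒IsKAssignment : ∀ {g} → InB L g → IsKAssignment (suc m) (L' L g)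
      bad⇒IsKAssignment {g} (_ , ¬col) = uncolorable⇒IsKAssignment {G = M} constant ¬1-col (L' L g)
        (λ i → ∖-Unique (L (ιY i)) (colorsAt g i) (!Y i)) long (¬col ∘ LColorable-M⇒Hy)
        where
        open ≤-Reasoning
        long : ∀ i → suc m ≤ length (L' L g i)
        long i = +-cancelʳ-≤ a (suc m) _ (begin
          suc m + a                                  ≡⟨ |Y| i ⟨
          length (L (ιY i))                          ≤⟨ length-∖-lower (!Y i) ⟩
          length (L' L g i) + length (colorsAt g i)  ≡⟨ cong (length (L' L g i) +_) (length-colorsAt g i) ⟩
          length (L' L g i) + a                      ∎)

      length-L′ : ∀ {g} → InB L g → ∀ i → length (L' L g i) ≡ suc m
      length-L′ bg i = proj₂ (bad⇒IsKAssignment bg i)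

      bad⇒SameLists : ∀ {g} → InB L g → SameLists (L' L g)
      bad⇒SameLists bg@(_ , ¬col) = constant _ (bad⇒IsKAssignment bg) (¬col ∘ LColorable-M⇒Hy)

      bad⇒colorsAt⊆L[ιY] : ∀ {g} → InB L g → ∀ i → colorsAt g i ⊆ L (ιY i)
      bad⇒colorsAt⊆L[ιY] {g} bg i = length-∖-tight⇒⊆ (!Y i) (≤-reflexive (begin
        length (L' L g i) + length (colorsAt g i)  ≡⟨ cong₂ _+_ (length-L′ bg i) (length-colorsAt g i) ⟩
        suc m + a                                  ≡⟨ |Y| i ⟨
        length (L (ιY i))                          ∎))
        where open ≡-Reasoning

      module _ {f} (bf : InB L f) (n-1-to-1 : NToOne L f) {g} (bg : InB L g) where

        -- Both L' are constant, so a color kept by g but removed by f at one vertex is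
        -- removed by f, i.e. used by f, at every vertex.
        bad-lists-⊆ : ∀ i → L' L g i ⊆ L' L f i
        bad-lists-⊆ i {c} c∈L′g with c ∈? L' L f i
        ... | yes c∈L′f = c∈L′f
        ... | no c∉L′f  = contradiction c∈colorsAt (NToOne⇒¬∈-every-colorsAt n-1-to-1 i c)
          where
          c∈colorsAt : ∀ w → c ∈ colorsAt f w
          c∈colorsAt w = ∉-∖⇒∈ (L (ιY w)) (colorsAt f w)
            (∖-⊆ (L (ιY w)) (colorsAt g w) (Equivalence.to (bad⇒SameLists bg i w c) c∈L′g))
            (c∉L′f ∘ Equivalence.to (bad⇒SameLists bf w i c))

        bad-lists-⊇ : ∀ i → L' L f i ⊆ L' L g i
        bad-lists-⊇ i = ⊆-length≤⇒⊇ (proj₁ (bad⇒IsKAssignment bg i)) (bad-lists-⊆ i)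
          (≤-reflexive (trans (length-L′ bf i) (sym (length-L′ bg i))))

        bad-colorsAt-⊆ : ∀ i → colorsAt g i ⊆ colorsAt f i
        bad-colorsAt-⊆ i c∈colorsAt =
          ∉-∖⇒∈ (L (ιY i)) (colorsAt f i) (bad⇒colorsAt⊆L[ιY] bg i c∈colorsAt)
            (∈⇒∉-∖ (L (ιY i)) _ c∈colorsAt ∘ bad-lists-⊇ i)

        bad-unique : (∀ i j j' → j ≢ j' → ∀ c → c ∈ L (i , inj₁ j) → c ∉ L (i , inj₁ j')) →
          ∀ p → g p ≡ f p
        bad-unique disjoint (i , l)
          with l′ , f[i,l′]≡g[i,l] ← ∈-colorsAt⁻ f i (bad-colorsAt-⊆ i (∈-colorsAt⁺ g i l))
             | l ≟ᶠ l′
        ... | yes refl = sym f[i,l′]≡g[i,l]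
        ... | no l≢l′  = contradiction
          (subst (_∈ L (i , inj₁ l′)) f[i,l′]≡g[i,l] (proj₁ (proj₁ bf) (i , l′)))
          (disjoint i l l′ l≢l′ (g (i , l)) (proj₁ (proj₁ bg) (i , l)))

lemma13 : (k a : ℕ) → 2 ≤ k → 1 ≤ a →
    {n : ℕ} (M : Graph (Fin n)) → (∀ u v → Dec (Adj M u v)) →
    StronglyChromaticChoosable M k →
    (L : Assignment (Setting.VH M a)) → IsKAssignment (k + a ∸ 1) L →
    (∀ i j j' → j ≢ j' → ∀ c → c ∈ L (i , inj₁ j) → c ∉ L (i , inj₁ j')) →
    (f : Fin n × Fin a → ℕ) → Setting.InBI M a L f →
    (∀ g → Setting.InBI M a L g → ∀ p → g p ≡ f p) ×
    (∀ g → Setting.InB M a L g → Setting.NToOne M a L g)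
lemma13 (suc (suc m)) a (s≤s (s≤s z≤n)) _ M _ (critical , constant) L isK disjoint f
        (bf , n-1-to-1) =
  (λ _ (bg , _) → bad≗f bg) , (λ _ bg → NToOne-resp-≗ M a L (bad≗f bg) n-1-to-1)
  where
  ¬1-col : ¬ Colorable M 1
  ¬1-col = proj₂ (proj₁ critical) 1 (s≤s (s≤s z≤n))

  bad≗f : ∀ {g} → Setting.InB M a L g → ∀ p → g p ≡ f p
  bad≗f bg = bad-unique M a L constant ¬1-col isK bf n-1-to-1 bg disjoint
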